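{- Let $n\ge1$ and let $D_0(n)$ denote either of the checkered diagrams $Ch^1_n$ or $Ch^2_n$. Then $\mathcal{P}(D_0(n))$ is ranked if and only if $n\le 3$. Moreover, $\mathcal{P}(D_0(n))$ is both ranked and bounded if and only if $n\le 2$.
   Context: A diagram is a finite set $D$ of cells $(r,c)$ with $r,c$ positive integers; $r$ is the row (rows numbered from bottom to top starting at 1) and $c$ the column (numbered from left to right starting at 1). A Kohnert move at row $r$ applied to a diagram $D$: if row $r$ of $D$ is empty, $D$ is unchanged; otherwise let $(r,c)$ be the cell of row $r$ with the largest column index; if every position $(r',c)$ with $1\le r'<r$ belongs to $D$, then $D$ is unchanged; otherwise let $r'$ be the largest integer with $1\le r'<r$ and $(r',c)\notin D$, and the move replaces the cell $(r,c)$ by $(r',c)$. For a diagram $D_0$, $KD(D_0)$ is the set of all diagrams obtainable from $D_0$ by finite (possibly empty) sequences of Kohnert moves; the Kohnert poset $\mathcal{P}(D_0)$ is $KD(D_0)$ ordered by $D_2\preceq D_1$ iff $D_2$ can be obtained from $D_1$ by a finite sequence of Kohnert moves. A finite poset is bounded if it has a unique minimal and a unique maximal element; it is ranked if there is $\rho:P\to\mathbb{Z}_{\ge0}$ with $x\prec y\Rightarrow\rho(x)<\rho(y)$ and $\rho(y)=\rho(x)+1$ whenever $y$ covers $x$. Checkered diagrams: $Ch^1_n=\{(2i-1,2j-1):1\le i,j\le\lceil n/2\rceil\}\cup\{(2i,2j):1\le i,j\le\lfloor n/2\rfloor\}$ and $Ch^2_n=\{(2i-1,2j):1\le i\le\lceil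 n/2\rceil,\ 1\le j\le\lfloor n/2\rfloor\}\cup\{(2i,2j-1):1\le i\le\lfloor n/2\rfloor,\ 1\le j\le\lceil n/2\rceil\}$. -}

module Defs where

open import Data.Nat using (ℕ; suc; _≤_; _<_; _+_; _*_; _∸_; ⌊_/2⌋; ⌈_/2⌉)
open import Data.Product using (_×_; _,_; Σ; ∃; ∃-syntax)
open import Data.Sum using (_⊎_)
open import Data.List using (List; map; concatMap; upTo; _++_)
open import Data.List.Membership.Propositional using (_∈_; _∉_)
open import Relation.Binary.PropositionalEquality using (_≡_; _≢_)
open import Relation.Binary.Construct.Closure.ReflexiveTransitive using (Star)
open import Relation.Nullary using (¬_)
open import Data.Empty using (⊥)
open import Function.Bundles using (_⇔_)

-- A cell (r , c): r = row (bottom to top, from 1), c = column (from 1).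
Cell : Set
Cell = ℕ × ℕ

-- A diagram is a finite set of cells, represented by a list; the list is
-- read as a set (order and repetitions are irrelevant), see _≈D_.
Diagram : Set
Diagram = List Cell

_≈D_ : Diagram → Diagram → Set
D ≈D E = ∀ x → (x ∈ D) ⇔ (x ∈ E)

range1 : ℕ → List ℕ
range1 m = map suc (upTo m)

-- The cell (r , c)
-- is the rightmost cell of row r, r' is the largest row index below r
-- with (r' , c) ∉ D, and D' = (D ∖ {(r , c)}) ∪ {(r' , c)}.
-- (Moves leaving D unchanged are irrelevant for reachability.)
KohnertMove : Diagram → Diagram → Set
KohnertMove D D' =
  Σ ℕ λ r → Σ ℕ λ c → Σ ℕ λ r' →
    ((r , c) ∈ D)
  × (∀ c' → (r , c') ∈ D → c' ≤ c)
  × (1 ≤ r') × (r' < r)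
  × ((r' , c) ∉ D)
  × (∀ k → r' < k → k < r → (k , c) ∈ D)
  × (∀ x → (x ∈ D') ⇔ ((x ≡ (r' , c)) ⊎ ((x ∈ D) × (x ≢ (r , c)))))

_≼_ : Diagram → Diagram → Set
D₂ ≼ D₁ = ∃[ E ] (Star KohnertMove D₁ E × (D₂ ≈D E))

_≺_ : Diagram → Diagram → Set
D₂ ≺ D₁ = (D₂ ≼ D₁) × ¬ (D₂ ≈D D₁)

InKD : Diagram → Diagram → Set
InKD D₀ D = D ≼ D₀

Covers : Diagram → Diagram → Diagram → Set
Covers D₀ y x = InKD D₀ x × InKD D₀ y × (x ≺ y)
  × (∀ z → InKD D₀ z → x ≺ z → z ≺ y → ⊥)

Ranked : Diagram → Set
Ranked D₀ = Σ (Diagram → ℕ) λ ρ →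
    (∀ x y → InKD D₀ x → InKD D₀ y → x ≈D y → ρ x ≡ ρ y)
  × (∀ x y → InKD D₀ x → InKD D₀ y → x ≺ y → ρ x < ρ y)
  × (∀ x y → Covers D₀ y x → ρ y ≡ ρ x + 1)

Minimal Maximal : Diagram → Diagram → Set
Minimal D₀ m = InKD D₀ m × (∀ z → InKD D₀ z → ¬ (z ≺ m))
Maximal D₀ m = InKD D₀ m × (∀ z → InKD D₀ z → ¬ (m ≺ z))

Bounded : Diagram → Set
Bounded D₀ =
    (Σ Diagram λ m → Minimal D₀ m × (∀ m' → Minimal D₀ m' → m' ≈D m))
  × (Σ Diagram λ M → Maximal D₀ M × (∀ M' → Maximal D₀ M' → M' ≈D M))

Ch1 : ℕ → Diagram
Ch1 n =
     concatMap (λ i → map (λ j → (2 * i ∸ 1 , 2 * j ∸ 1)) (range1 ⌈ n /2⌉)) (range1 ⌈ n /2⌉)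
  ++ concatMap (λ i → map (λ j → (2 * i , 2 * j)) (range1 ⌊ n /2⌋)) (range1 ⌊ n /2⌋)

Ch2 : ℕ → Diagram
Ch2 n =
     concatMap (λ i → map (λ j → (2 * i ∸ 1 , 2 * j)) (range1 ⌊ n /2⌋)) (range1 ⌈ n /2⌉)
  ++ concatMap (λ i → map (λ j → (2 * i , 2 * j ∸ 1)) (range1 ⌈ n /2⌉)) (range1 ⌊ n /2⌋)

-- The weight of a diagram, the sum of the row indices of its cells, drops by exactly r − r' under
-- a Kohnert move from row r to row r'.
--
-- For n ≤ 3 no column of a checkered diagram contains two adjacent cells, so every column occupied
-- in rows 2 and 3 is occupied in row 1. Within three rows this property is preserved by moves and
-- forces every move to lower its cell by one row, so the weight is a rank function. The initial
-- diagram, of largest weight, is the unique maximum; the minimal elements are found by computation: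
-- one for n ≤ 2, two for n = 3.
--
-- For n ≥ 4 the diagram contains a zigzag: cells (r+2,c), (r+3,c+1), (r+4,c), rightmost in their
-- rows, with (r+1,c), (r+2,c+1), (r+3,c) empty. After lowering (r+4,c), two routes reach the same
-- diagram: three unit moves, or a unit move followed by a jump of (r+3,c) over (r+2,c) to (r+1,c).
-- The jump is a cover, because the cell then standing right of (r+2,c) prevents splitting it into
-- two unit moves. A rank function changes like the weight along unit moves but by one across this
-- cover, so the two routes give contradictory ranks.

{-# OPTIONS --safe #-}
module Submission where

open import Defs
open import Data.Empty using (⊥; ⊥-elim)
open import Data.List using (_∷_; map; concatMap; filter; upTo)
open import Data.List.Membership.Propositional using (_∈_; _∉_; find; lose)
open import Data.List.Membership.Propositional.Properties
  using (∈-map⁺; ∈-map⁻; ∈-upTo⁺; ∈-upTo⁻; ∈-concatMap⁺; ∈-concatMap⁻; ∈-++⁺ˡ; ∈-++⁺ʳ; ∈-++⁻; ∈-filter⁺; ∈-filter⁻)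
open import Data.List.Relation.Unary.All using (All; all?) renaming (lookup to All-lookup)
open import Data.List.Relation.Unary.Any using (Any; any?; here; there)
open import Data.Nat
open import Data.Nat.Properties
open import Data.Parity.Base as ℙ using (Parity; 0ℙ; 1ℙ)
import Data.Parity.Properties as ℙ
open import Algebra.Properties.CommutativeSemigroup +-commutativeSemigroup using (interchange)
open import Data.Product as Product using (Σ; Σ-syntax; ∃-syntax; _×_; _,_; proj₁; proj₂)
open import Data.Product.Properties using (≡-dec)
open import Data.Sum as Sum using (_⊎_; inj₁; inj₂)
open import Function.Base using (_∘_)
open import Function.Bundles using (_⇔_; mk⇔; Equivalence)
import Function.Properties.Equivalence as ⇔
open import Relation.Binary.Construct.Closure.ReflexiveTransitive using (Star; ε; _◅_; _◅◅_)
open import Relation.Binary.Definitions using (DecidableEquality)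
open import Relation.Binary.PropositionalEquality
open import Relation.Nullary using (¬_; Dec; yes; no)
open import Relation.Nullary.Decidable using (True; toWitness; ¬?; _×-dec_; _⊎-dec_; _→-dec_)

_≟ᶜ_ : DecidableEquality Cell
_≟ᶜ_ = ≡-dec _≟_ _≟_

open import Data.List.Membership.DecPropositional _≟ᶜ_ using (_∈?_)

≈D-refl : ∀ {D} → D ≈D D
≈D-refl x = ⇔.refl

≈D-sym : ∀ {D E} → D ≈D E → E ≈D D
≈D-sym D≈E x = ⇔.sym (D≈E x)

≈D-trans : ∀ {D E F} → D ≈D E → E ≈D F → D ≈D F
≈D-trans D≈E E≈F x = ⇔.trans (D≈E x) (E≈F x)

-- Kohnert moves

module _ {D D' : Diagram} where

  from-row to-row column : KohnertMove D D' → ℕ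
  from-row (r , _) = r
  column (_ , c , _) = c
  to-row (_ , _ , r' , _) = r'

  source target : KohnertMove D D' → Cell
  source m = from-row m , column m
  target m = to-row m , column m

  source∈ : (m : KohnertMove D D') → source m ∈ D
  source∈ (_ , _ , _ , p , _) = p

  source-rightmost : (m : KohnertMove D D') → ∀ c → (from-row m , c) ∈ D → c ≤ column m
  source-rightmost (_ , _ , _ , _ , p , _) = p

  to-row-pos : (m : KohnertMove D D') → 1 ≤ to-row m
  to-row-pos (_ , _ , _ , _ , _ , p , _) = p

  to-row<from-row : (m : KohnertMove D D') → to-row m < from-row m
  to-row<from-row (_ , _ , _ , _ , _ , _ , p , _) = p

  target∉ : (m : KohnertMove D D') → target m ∉ D
  target∉ (_ , _ , _ , _ , _ , _ , _ , p , _) = p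

  filled-between : (m : KohnertMove D D') → ∀ k → to-row m < k → k < from-row m → (k , column m) ∈ D
  filled-between (_ , _ , _ , _ , _ , _ , _ , _ , p , _) = p

  after⁻ : (m : KohnertMove D D') → ∀ {x} → x ∈ D' → x ≡ target m ⊎ (x ∈ D × x ≢ source m)
  after⁻ (_ , _ , _ , _ , _ , _ , _ , _ , _ , p) = Equivalence.to (p _)

  after⁺ : (m : KohnertMove D D') → ∀ {x} → x ≡ target m ⊎ (x ∈ D × x ≢ source m) → x ∈ D'
  after⁺ (_ , _ , _ , _ , _ , _ , _ , _ , _ , p) = Equivalence.from (p _)

  source∉after : (m : KohnertMove D D') → source m ∉ D'
  source∉after m p with after⁻ m p
  ... | inj₁ eq = <-irrefl (cong proj₁ (sym eq)) (to-row<from-row m)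
  ... | inj₂ (_ , ≢source) = ≢source refl

move-resp-≈ : ∀ {D E D'} → D ≈D E → KohnertMove D D' → KohnertMove E D'
move-resp-≈ D≈E (r , c , r' , src , rightmost , pos , r'<r , tgt , between , after) =
  r , c , r' , to src , (λ c' p → rightmost c' (from p)) , pos , r'<r , (λ p → tgt (from p)) ,
  (λ k p q → to (between k p q)) , λ x → ⇔.trans (after x) (mk⇔ (Sum.map₂ (Product.map₁ to)) (Sum.map₂ (Product.map₁ from)))
  where
  to : ∀ {x} → x ∈ _ → x ∈ _
  to {x} = Equivalence.to (D≈E x)
  from : ∀ {x} → x ∈ _ → x ∈ _
  from {x} = Equivalence.from (D≈E x)

-- Kept opaque so that implicit arguments are inferred from move (r , c) r' D itself rather than
-- from its unfolding; computations with concrete diagrams unfold it explicitly.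
opaque
  move : Cell → ℕ → Diagram → Diagram
  move (r , c) r' D = (r' , c) ∷ filter (λ x → ¬? (x ≟ᶜ (r , c))) D

  ∈-move⁻ : ∀ {r c r' D x} → x ∈ move (r , c) r' D → x ≡ (r' , c) ⊎ (x ∈ D × x ≢ (r , c))
  ∈-move⁻ (here eq) = inj₁ eq
  ∈-move⁻ {r} {c} {D = D} (there p) = inj₂ (∈-filter⁻ (λ x → ¬? (x ≟ᶜ (r , c))) {xs = D} p)

  ∈-move⁺ : ∀ {r c r' D x} → x ≡ (r' , c) ⊎ (x ∈ D × x ≢ (r , c)) → x ∈ move (r , c) r' D
  ∈-move⁺ (inj₁ eq) = here eq
  ∈-move⁺ {r} {c} (inj₂ (p , ≢rc)) = there (∈-filter⁺ (λ x → ¬? (x ≟ᶜ (r , c))) p ≢rc)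

∈-move-new : ∀ {r c r' D} → (r' , c) ∈ move (r , c) r' D
∈-move-new = ∈-move⁺ (inj₁ refl)

∈-move-old : ∀ {r c r' D x} → x ∈ D → x ≢ (r , c) → x ∈ move (r , c) r' D
∈-move-old x∈D x≢rc = ∈-move⁺ (inj₂ (x∈D , x≢rc))

kohnertMove : ∀ {D r c r'} → (r , c) ∈ D → (∀ c' → (r , c') ∈ D → c' ≤ c) → 1 ≤ r' → r' < r →
              (r' , c) ∉ D → (∀ k → r' < k → k < r → (k , c) ∈ D) → KohnertMove D (move (r , c) r' D)
kohnertMove src rightmost pos r'<r tgt between =
  _ , _ , _ , src , rightmost , pos , r'<r , tgt , between , λ x → mk⇔ ∈-move⁻ ∈-move⁺

≈move : ∀ {D D'} (m : KohnertMove D D') → D' ≈D move (source m) (to-row m) D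
≈move m x = mk⇔ (λ p → ∈-move⁺ (after⁻ m p)) (λ p → after⁺ m (∈-move⁻ p))

UnitMove : Diagram → Diagram → Set
UnitMove D D' = Σ (KohnertMove D D') λ m → from-row m ≡ suc (to-row m)

unitMove : ∀ {D r c} → (suc r , c) ∈ D → (∀ c' → (suc r , c') ∈ D → c' ≤ c) → 1 ≤ r → (r , c) ∉ D →
           UnitMove D (move (suc r , c) r D)
unitMove src rightmost pos tgt =
  kohnertMove src rightmost pos ≤-refl tgt (λ k r<k k<1+r → ⊥-elim (<-irrefl refl (<-≤-trans r<k (≤-pred k<1+r)))) , refl

-- The weight of a diagram

δ : ℕ → ℕ → ℕ → ℕ
δ a v i with i ≟ a
... | yes _ = v
... | no  _ = 0

δ-same : ∀ a v → δ a v a ≡ v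
δ-same a v with a ≟ a
... | yes _ = refl
... | no a≢a = ⊥-elim (a≢a refl)

δ-other : ∀ {a i} v → i ≢ a → δ a v i ≡ 0
δ-other {a} {i} v i≢a with i ≟ a
... | yes i≡a = ⊥-elim (i≢a i≡a)
... | no  _ = refl

δ-zero : ∀ a i → δ a 0 i ≡ 0
δ-zero a i with i ≟ a
... | yes _ = refl
... | no  _ = refl

∑< : ℕ → (ℕ → ℕ) → ℕ
∑< zero    f = 0
∑< (suc N) f = f N + ∑< N f

∑<-cong : ∀ N {f g} → (∀ i → f i ≡ g i) → ∑< N f ≡ ∑< N g
∑<-cong zero    f≗g = refl
∑<-cong (suc N) f≗g = cong₂ _+_ (f≗g N) (∑<-cong N f≗g)

∑<-+ : ∀ N (f g : ℕ → ℕ) → ∑< N (λ i → f i + g i) ≡ ∑< N f + ∑< N g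
∑<-+ zero    f g = refl
∑<-+ (suc N) f g = trans (cong (f N + g N +_) (∑<-+ N f g)) (interchange (f N) (g N) (∑< N f) (∑< N g))

∑<-zero : ∀ N → ∑< N (λ _ → 0) ≡ 0
∑<-zero zero    = refl
∑<-zero (suc N) = ∑<-zero N

∑<-δ-beyond : ∀ {N a} v → N ≤ a → ∑< N (δ a v) ≡ 0
∑<-δ-beyond {zero}  v _ = refl
∑<-δ-beyond {suc N} v 1+N≤a = cong₂ _+_ (δ-other v (<⇒≢ 1+N≤a)) (∑<-δ-beyond v (<⇒≤ 1+N≤a))

∑<-δ : ∀ {N a} v → a < N → ∑< N (δ a v) ≡ v
∑<-δ {suc N} {a} v a<1+N with N ≟ a
... | yes refl = trans (cong (v +_) (∑<-δ-beyond {N} v ≤-refl)) (+-identityʳ v)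
... | no  N≢a  = ∑<-δ v (≤∧≢⇒< (≤-pred a<1+N) (N≢a ∘ sym))

∑<-δ-outer : ∀ N a (g : ℕ → ℕ) i → ∑< N (λ j → δ a (g j) i) ≡ δ a (∑< N g) i
∑<-δ-outer N a g i with i ≟ a
... | yes _ = refl
... | no  _ = ∑<-zero N

∑□ : ℕ → (Cell → ℕ) → ℕ
∑□ N f = ∑< N λ r → ∑< N λ c → f (r , c)

∑□-cong : ∀ N {f g} → (∀ x → f x ≡ g x) → ∑□ N f ≡ ∑□ N g
∑□-cong N f≗g = ∑<-cong N λ r → ∑<-cong N λ c → f≗g (r , c)

∑□-+ : ∀ N (f g : Cell → ℕ) → ∑□ N (λ x → f x + g x) ≡ ∑□ N f + ∑□ N g
∑□-+ N f g = trans (∑<-cong N λ r → ∑<-+ N _ _) (∑<-+ N _ _)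

point : Cell → ℕ → Cell → ℕ
point (a , b) v (r , c) = δ a (δ b v c) r

point-same : ∀ x v → point x v x ≡ v
point-same (a , b) v = trans (δ-same a _) (δ-same b v)

point-other : ∀ {x y} v → y ≢ x → point x v y ≡ 0
point-other {a , b} {r , c} v y≢x = by-cases (r ≟ a) (c ≟ b)
  where
  by-cases : Dec (r ≡ a) → Dec (c ≡ b) → δ a (δ b v c) r ≡ 0
  by-cases (yes refl) (yes refl) = ⊥-elim (y≢x refl)
  by-cases (yes refl) (no c≢b)   = trans (cong (λ w → δ a w a) (δ-other v c≢b)) (δ-zero a a)
  by-cases (no r≢a)   _          = δ-other _ r≢a

∑□-point : ∀ {N a b} v → a < N → b < N → ∑□ N (point (a , b) v) ≡ v
∑□-point {N} {a} {b} v a<N b<N =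
  trans (∑<-cong N λ r → trans (∑<-δ-outer N a (λ c → δ b v c) r) (cong (λ w → δ a w r) (∑<-δ v b<N)))
        (∑<-δ v a<N)

InBox : ℕ → Diagram → Set
InBox N D = ∀ {r c} → (r , c) ∈ D → r < N × c < N

rowWeight : Diagram → Cell → ℕ
rowWeight D x with x ∈? D
... | yes _ = proj₁ x
... | no  _ = 0

rowWeight-∈ : ∀ {D x} → x ∈ D → rowWeight D x ≡ proj₁ x
rowWeight-∈ {D} {x} x∈D with x ∈? D
... | yes _   = refl
... | no  x∉D = ⊥-elim (x∉D x∈D)

rowWeight-∉ : ∀ {D x} → x ∉ D → rowWeight D x ≡ 0
rowWeight-∉ {D} {x} x∉D with x ∈? D
... | yes x∈D = ⊥-elim (x∉D x∈D)
... | no  _   = refl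

rowWeight-resp : ∀ {D E x} → (x ∈ D ⇔ x ∈ E) → rowWeight D x ≡ rowWeight E x
rowWeight-resp {D} {E} {x} x∈D⇔x∈E with x ∈? D | x ∈? E
... | yes _   | yes _   = refl
... | no  _   | no  _   = refl
... | yes x∈D | no  x∉E = ⊥-elim (x∉E (Equivalence.to x∈D⇔x∈E x∈D))
... | no  x∉D | yes x∈E = ⊥-elim (x∉D (Equivalence.from x∈D⇔x∈E x∈E))

weight : ℕ → Diagram → ℕ
weight N D = ∑□ N (rowWeight D)

weight-resp-≈ : ∀ N {D E} → D ≈D E → weight N D ≡ weight N E
weight-resp-≈ N D≈E = ∑□-cong N λ x → rowWeight-resp (D≈E x)

rowWeight-move : ∀ {D D'} (m : KohnertMove D D') x →
  rowWeight D' x + point (source m) (from-row m) x ≡ rowWeight D x + point (target m) (to-row m) x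
rowWeight-move m x with x ≟ᶜ source m | x ≟ᶜ target m
... | yes refl | yes eq = ⊥-elim (<-irrefl (cong proj₁ (sym eq)) (to-row<from-row m))
... | yes refl | no x≢tgt =
  trans (cong₂ _+_ (rowWeight-∉ (source∉after m)) (point-same (source m) _))
        (sym (trans (cong₂ _+_ (rowWeight-∈ (source∈ m)) (point-other _ x≢tgt)) (+-identityʳ _)))
... | no x≢src | yes refl =
  trans (cong₂ _+_ (rowWeight-∈ (after⁺ m (inj₁ refl))) (point-other _ x≢src))
        (trans (+-identityʳ _) (sym (cong₂ _+_ (rowWeight-∉ (target∉ m)) (point-same (target m) _))))
... | no x≢src | no x≢tgt =
  cong₂ _+_ (rowWeight-resp (mk⇔ stays (λ x∈D → after⁺ m (inj₂ (x∈D , x≢src)))))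
            (trans (point-other _ x≢src) (sym (point-other _ x≢tgt)))
  where
  stays : x ∈ _ → x ∈ _
  stays x∈D' with after⁻ m x∈D'
  ... | inj₁ x≡tgt   = ⊥-elim (x≢tgt x≡tgt)
  ... | inj₂ (x∈D , _) = x∈D

weight-move : ∀ {N D D'} → InBox N D → (m : KohnertMove D D') → weight N D' + from-row m ≡ weight N D + to-row m
weight-move {N} {D} {D'} box m = begin
  weight N D' + from-row m                                      ≡⟨ cong (weight N D' +_) (sym (∑□-point _ src-row< src-col<)) ⟩
  weight N D' + ∑□ N (point (source m) (from-row m))            ≡⟨ sym (∑□-+ N _ _) ⟩
  ∑□ N (λ x → rowWeight D' x + point (source m) (from-row m) x) ≡⟨ ∑□-cong N (rowWeight-move m) ⟩
  ∑□ N (λ x → rowWeight D x + point (target m) (to-row m) x)    ≡⟨ ∑□-+ N _ _ ⟩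
  weight N D + ∑□ N (point (target m) (to-row m))               ≡⟨ cong (weight N D +_) (∑□-point _ (<-trans (to-row<from-row m) src-row<) src-col<) ⟩
  weight N D + to-row m                                         ∎
  where
  open ≡-Reasoning
  src-row< : from-row m < N
  src-row< = proj₁ (box (source∈ m))
  src-col< : column m < N
  src-col< = proj₂ (box (source∈ m))

weight-move-< : ∀ {N D D'} → InBox N D → (m : KohnertMove D D') → weight N D' < weight N D
weight-move-< {N} {D} {D'} box m = +-cancelʳ-< (from-row m) (weight N D') (weight N D)
  (subst (_< weight N D + from-row m) (sym (weight-move box m)) (+-monoʳ-< (weight N D) (to-row<from-row m)))

weight-move-by : ∀ {N D D'} d → InBox N D → (m : KohnertMove D D') →
                 from-row m ≡ d + to-row m → weight N D ≡ d + weight N D'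
weight-move-by {N} {D} {D'} d box m drop = trans (sym (+-cancelʳ-≡ (to-row m) _ _ eq)) (+-comm (weight N D') d)
  where
  eq : weight N D' + d + to-row m ≡ weight N D + to-row m
  eq = trans (+-assoc (weight N D') d (to-row m)) (trans (cong (weight N D' +_) (sym drop)) (weight-move box m))

weight-move-by⁻¹ : ∀ {N D D'} d → InBox N D → (m : KohnertMove D D') →
                   weight N D ≡ d + weight N D' → from-row m ≡ d + to-row m
weight-move-by⁻¹ {N} {D} {D'} d box m drop = +-cancelˡ-≡ (weight N D') _ _ (begin
  weight N D' + from-row m      ≡⟨ weight-move box m ⟩
  weight N D + to-row m         ≡⟨ cong (_+ to-row m) drop ⟩
  d + weight N D' + to-row m    ≡⟨ cong (_+ to-row m) (+-comm d (weight N D')) ⟩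
  weight N D' + d + to-row m    ≡⟨ +-assoc (weight N D') d (to-row m) ⟩
  weight N D' + (d + to-row m)  ∎)
  where open ≡-Reasoning

InBox-move : ∀ {N D D'} → InBox N D → KohnertMove D D' → InBox N D'
InBox-move box m p with after⁻ m p
... | inj₁ refl = <-trans (to-row<from-row m) (proj₁ (box (source∈ m))) , proj₂ (box (source∈ m))
... | inj₂ (p∈D , _) = box p∈D

InBox-moves : ∀ {N D E} → InBox N D → Star KohnertMove D E → InBox N E
InBox-moves box ε        = box
InBox-moves box (m ◅ ms) = InBox-moves (InBox-move box m) ms

InBox-resp-≈ : ∀ {N D E} → D ≈D E → InBox N E → InBox N D
InBox-resp-≈ D≈E box p = box (Equivalence.to (D≈E _) p)

weight-moves : ∀ {N D E} → InBox N D → Star KohnertMove D E → D ≡ E ⊎ weight N E < weight N D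
weight-moves box ε = inj₁ refl
weight-moves box (m ◅ ms) with weight-moves (InBox-move box m) ms
... | inj₁ refl = inj₂ (weight-move-< box m)
... | inj₂ lt   = inj₂ (<-trans lt (weight-move-< box m))

≼⇒weight≤ : ∀ {N x y} → InBox N y → x ≼ y → weight N x ≤ weight N y
≼⇒weight≤ {N} box (E , ms , x≈E) with weight-moves box ms
... | inj₁ refl = ≤-reflexive (weight-resp-≈ N x≈E)
... | inj₂ lt   = <⇒≤ (subst (_< _) (sym (weight-resp-≈ N x≈E)) lt)

≺⇒weight< : ∀ {N x y} → InBox N y → x ≺ y → weight N x < weight N y
≺⇒weight< {N} box ((E , ms , x≈E) , x≉y) with weight-moves box ms
... | inj₁ refl = ⊥-elim (x≉y x≈E)
... | inj₂ lt   = subst (_< _) (sym (weight-resp-≈ N x≈E)) lt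

move⇒≺ : ∀ {N y x} → InBox N y → KohnertMove y x → x ≺ y
move⇒≺ {N} box m = (_ , m ◅ ε , ≈D-refl) , λ x≈y → <-irrefl (weight-resp-≈ N x≈y) (weight-move-< box m)

≺-first-move : ∀ {N y z} → InBox N y → z ≺ y →
  Σ[ y₁ ∈ Diagram ] Σ[ m ∈ KohnertMove y y₁ ] (weight N z ≤ weight N y₁ × (weight N z ≡ weight N y₁ → z ≈D y₁))
≺-first-move box ((E , ε , z≈E) , z≉y) = ⊥-elim (z≉y z≈E)
≺-first-move {N} {z = z} box ((E , m ◅ ms , z≈E) , _) =
  _ , m , ≼⇒weight≤ (InBox-move box m) (E , ms , z≈E) , equal-weight (weight-moves (InBox-move box m) ms)
  where
  equal-weight : ∀ {y₁} → y₁ ≡ E ⊎ weight N E < weight N y₁ → weight N z ≡ weight N y₁ → z ≈D y₁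
  equal-weight (inj₁ refl) _  = z≈E
  equal-weight (inj₂ lt)   eq = ⊥-elim (<-irrefl (trans (sym (weight-resp-≈ N z≈E)) eq) lt)

-- Covers and rank functions

squeeze : ∀ {a b c d} → a ≤ b → b < c → c ≤ d → d < 2 + a → b ≡ a × c ≡ suc a × d ≡ suc a
squeeze {a} {b} {c} {d} a≤b b<c c≤d d<2+a = b≡a , c≡1+a , ≤-antisym d≤1+a (subst (_≤ _) c≡1+a c≤d)
  where
  d≤1+a : d ≤ suc a
  d≤1+a = ≤-pred d<2+a
  c≤1+a : c ≤ suc a
  c≤1+a = ≤-trans c≤d d≤1+a
  b≡a : b ≡ a
  b≡a = ≤-antisym (≤-pred (≤-trans b<c c≤1+a)) a≤b
  c≡1+a : c ≡ suc a
  c≡1+a = ≤-antisym c≤1+a (subst (_< _) b≡a b<c)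

module _ {y x : Diagram} (m : KohnertMove y x) (skip : from-row m ≡ 2 + to-row m) where

  private
    middle : Cell
    middle = 1 + to-row m , column m

    middle∈ : middle ∈ y
    middle∈ = filled-between m _ ≤-refl (subst (_ <_) (sym skip) (n<1+n _))

    middle≡target : ∀ {D D'} (m' : KohnertMove D D') → from-row m' ≡ suc (to-row m') →
                    source m ≡ source m' → middle ≡ target m'
    middle≡target m' unit' eq = cong₂ _,_ (cong pred (trans (sym skip) (trans (cong proj₁ eq) unit'))) (cong proj₂ eq)

  -- The skipped cell blocks the source from moving first, and it cannot move itself because a cell
  -- lies to its right.
  skip≉unit∘unit : ∀ {y₁ z₂ c'} → (1 + to-row m , c') ∈ y → column m < c' →
    (m₁ : KohnertMove y y₁) → from-row m₁ ≡ suc (to-row m₁) →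
    (m₂ : KohnertMove y₁ z₂) → from-row m₂ ≡ suc (to-row m₂) → ¬ (z₂ ≈D x)
  skip≉unit∘unit {c' = c'} right∈ right< m₁ unit₁ m₂ unit₂ z₂≈x with source m ≟ᶜ source m₁
  ... | yes src≡src₁ = target∉ m₁ (subst (_∈ y) (middle≡target m₁ unit₁ src≡src₁) middle∈)
  ... | no src≢src₁ with source m ≟ᶜ source m₂
  ...   | no src≢src₂ =
    source∉after m (Equivalence.to (z₂≈x _) (after⁺ m₂ (inj₂ (after⁺ m₁ (inj₂ (source∈ m , src≢src₁)) , src≢src₂))))
  ...   | yes src≡src₂ with middle ≟ᶜ source m₁
  ...     | no mid≢src₁ =
    target∉ m₂ (subst (_∈ _) (middle≡target m₂ unit₂ src≡src₂) (after⁺ m₁ (inj₂ (middle∈ , mid≢src₁))))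
  ...     | yes mid≡src₁ = <-irrefl refl (<-≤-trans right< (subst (c' ≤_) (sym (cong proj₂ mid≡src₁))
                             (source-rightmost m₁ c' (subst (λ r → (r , c') ∈ y) (cong proj₁ mid≡src₁) right∈))))

InKD-refl : ∀ {D₀} → InKD D₀ D₀
InKD-refl = _ , ε , ≈D-refl

InKD-move : ∀ {D₀ y y'} → InKD D₀ y → KohnertMove y y' → InKD D₀ y'
InKD-move (E , ms , y≈E) m = _ , ms ◅◅ (move-resp-≈ y≈E m ◅ ε) , ≈D-refl

InKD-unitMoves : ∀ {D₀ a z} → InKD D₀ a → Star UnitMove a z → InKD D₀ z
InKD-unitMoves a∈ ε              = a∈
InKD-unitMoves a∈ ((m , _) ◅ ms) = InKD-unitMoves (InKD-move a∈ m) ms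

module _ {N D₀} (box₀ : InBox N D₀) where

  InKD-box : ∀ {x} → InKD D₀ x → InBox N x
  InKD-box (E , ms , x≈E) = InBox-resp-≈ x≈E (InBox-moves box₀ ms)

  unitMove⇒Covers : ∀ {y x} → InKD D₀ y → (m : KohnertMove y x) → from-row m ≡ suc (to-row m) → Covers D₀ y x
  unitMove⇒Covers {y} {x} y∈ m unit = InKD-move y∈ m , y∈ , move⇒≺ box m , λ z z∈ x≺z z≺y →
    <-irrefl refl (≤-<-trans (subst (_≤ weight N z) (sym (weight-move-by 1 box m unit)) (≺⇒weight< (InKD-box z∈) x≺z))
                             (≺⇒weight< box z≺y))
    where box = InKD-box y∈

  skipMove⇒Covers : ∀ {y x c'} → InKD D₀ y → (m : KohnertMove y x) → from-row m ≡ 2 + to-row m →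
                    (1 + to-row m , c') ∈ y → column m < c' → Covers D₀ y x
  skipMove⇒Covers {y} {x} y∈ m skip right∈ right< = InKD-move y∈ m , y∈ , move⇒≺ box m , no-between
    where
    box : InBox N y
    box = InKD-box y∈
    -- By the weight gap of 2, an element strictly between would be reached by two unit moves.
    no-between : ∀ z → InKD D₀ z → x ≺ z → z ≺ y → ⊥
    no-between z z∈ x≺z z≺y with ≺-first-move box z≺y | ≺-first-move (InKD-box z∈) x≺z
    ... | y₁ , m₁ , z≤y₁ , z≈y₁ | z₂ , m₂ , x≤z₂ , x≈z₂ =
      skip≉unit∘unit m skip right∈ right< m₁ unit₁ (move-resp-≈ (z≈y₁ z≡y₁) m₂) unit₂ (≈D-sym (x≈z₂ (sym z₂≡x)))
      where
      weight-y : weight N y ≡ 2 + weight N x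
      weight-y = weight-move-by 2 box m skip
      squeezed : weight N z₂ ≡ weight N x × weight N z ≡ suc (weight N x) × weight N y₁ ≡ suc (weight N x)
      squeezed = squeeze x≤z₂ (weight-move-< (InKD-box z∈) m₂) z≤y₁ (subst (weight N y₁ <_) weight-y (weight-move-< box m₁))
      z₂≡x : weight N z₂ ≡ weight N x
      z₂≡x = proj₁ squeezed
      z≡1+x : weight N z ≡ suc (weight N x)
      z≡1+x = proj₁ (proj₂ squeezed)
      y₁≡1+x : weight N y₁ ≡ suc (weight N x)
      y₁≡1+x = proj₂ (proj₂ squeezed)
      z≡y₁ : weight N z ≡ weight N y₁
      z≡y₁ = trans z≡1+x (sym y₁≡1+x)
      unit₁ : from-row m₁ ≡ suc (to-row m₁)
      unit₁ = weight-move-by⁻¹ 1 box m₁ (trans weight-y (cong suc (sym y₁≡1+x)))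
      unit₂ : from-row m₂ ≡ suc (to-row m₂)
      unit₂ = weight-move-by⁻¹ 1 (InKD-box z∈) m₂ (trans z≡1+x (cong suc (sym z₂≡x)))

  rank-tracks-weight : (ρ : Diagram → ℕ) → (∀ x y → Covers D₀ y x → ρ y ≡ ρ x + 1) →
                       ∀ {a z} → InKD D₀ a → Star UnitMove a z → ρ a + weight N z ≡ ρ z + weight N a
  rank-tracks-weight ρ ρ-cover a∈ ε = refl
  rank-tracks-weight ρ ρ-cover {a} {z} a∈ (_◅_ {j = a₁} (m , unit) ms) = begin
    ρ a + weight N z         ≡⟨ cong (_+ weight N z) (ρ-cover _ _ (unitMove⇒Covers a∈ m unit)) ⟩
    ρ a₁ + 1 + weight N z    ≡⟨ trans (+-assoc (ρ a₁) 1 _) (+-suc (ρ a₁) _) ⟩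
    suc (ρ a₁ + weight N z)  ≡⟨ cong suc (rank-tracks-weight ρ ρ-cover (InKD-move a∈ m) ms) ⟩
    suc (ρ z + weight N a₁)  ≡⟨ sym (+-suc (ρ z) _) ⟩
    ρ z + suc (weight N a₁)  ≡⟨ cong (ρ z +_) (sym (weight-move-by 1 (InKD-box a∈) m unit)) ⟩
    ρ z + weight N a         ∎
    where open ≡-Reasoning

  skip-and-unitMoves⇒¬Ranked : ∀ {a y x x' c'} → InKD D₀ a → Star UnitMove a y →
    (m : KohnertMove y x) → from-row m ≡ 2 + to-row m → (1 + to-row m , c') ∈ y → column m < c' →
    Star UnitMove a x' → x ≈D x' → ¬ Ranked D₀
  skip-and-unitMoves⇒¬Ranked {a} {y} {x} {x'} a∈ a→y m skip right∈ right< a→x' x≈x' (ρ , ρ-resp , _ , ρ-cover) =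
    1+n≢n (begin
      2 + (ρ a + weight N x')      ≡⟨ cong suc (sym (+-suc (ρ a) _)) ⟩
      suc (ρ a + suc (weight N x')) ≡⟨ sym (+-suc (ρ a) _) ⟩
      ρ a + (2 + weight N x')  ≡⟨ cong (ρ a +_) (sym weight-y) ⟩
      ρ a + weight N y         ≡⟨ rank-tracks-weight ρ ρ-cover a∈ a→y ⟩
      ρ y + weight N a         ≡⟨ cong (_+ weight N a) ρ-y ⟩
      ρ x + 1 + weight N a     ≡⟨ trans (+-assoc (ρ x) 1 _) (+-suc (ρ x) _) ⟩
      suc (ρ x + weight N a)   ≡⟨ cong (λ k → suc (k + weight N a)) ρ-x ⟩
      suc (ρ x' + weight N a)  ≡⟨ cong suc (sym (rank-tracks-weight ρ ρ-cover a∈ a→x')) ⟩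
      suc (ρ a + weight N x')  ∎)
    where
    open ≡-Reasoning
    y∈ : InKD D₀ y
    y∈ = InKD-unitMoves a∈ a→y
    weight-y : weight N y ≡ 2 + weight N x'
    weight-y = trans (weight-move-by 2 (InKD-box y∈) m skip) (cong (2 +_) (weight-resp-≈ N x≈x'))
    ρ-y : ρ y ≡ ρ x + 1
    ρ-y = ρ-cover x y (skipMove⇒Covers y∈ m skip right∈ right<)
    ρ-x : ρ x ≡ ρ x'
    ρ-x = ρ-resp x x' (InKD-move y∈ m) (InKD-unitMoves a∈ a→x') x≈x'

-- The zigzag obstruction

record Zigzag (D : Diagram) (r c : ℕ) : Set where
  field
    lower∈           : (2 + r , c) ∈ D
    middle∈          : (3 + r , suc c) ∈ D
    upper∈           : (4 + r , c) ∈ D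
    gap₁             : (1 + r , c) ∉ D
    gap₂             : (2 + r , suc c) ∉ D
    gap₃             : (3 + r , c) ∉ D
    lower-rightmost  : ∀ c' → (2 + r , c') ∈ D → c' ≤ c
    middle-rightmost : ∀ c' → (3 + r , c') ∈ D → c' ≤ suc c
    upper-rightmost  : ∀ c' → (4 + r , c') ∈ D → c' ≤ c

≤-suc-≢ : ∀ {m n} → m ≤ suc n → m ≢ suc n → m ≤ n
≤-suc-≢ m≤1+n m≢1+n = ≤-pred (≤∧≢⇒< m≤1+n m≢1+n)

module _ {N D r c} (box : InBox N D) (zigzag : Zigzag D r c) where
  open Zigzag zigzag

  private
    a y x p₁ p₂ x' : Diagram
    a  = move (4 + r , c) (3 + r) D
    y  = move (3 + r , suc c) (2 + r) a
    x  = move (3 + r , c) (1 + r) y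
    p₁ = move (2 + r , c) (1 + r) a
    p₂ = move (3 + r , suc c) (2 + r) p₁
    x' = move (3 + r , c) (2 + r) p₂

    a-row₃ : ∀ c' → (3 + r , c') ∈ a → c' ≤ suc c
    a-row₃ c' p with ∈-move⁻ p
    ... | inj₁ refl     = n≤1+n c
    ... | inj₂ (p∈D , _) = middle-rightmost c' p∈D

    a-row₃-left : ∀ c' → (3 + r , c') ∈ a → c' ≢ suc c → c' ≤ c
    a-row₃-left c' p = ≤-suc-≢ (a-row₃ c' p)

    a∌gap₁ : (1 + r , c) ∉ a
    a∌gap₁ p with ∈-move⁻ p
    ... | inj₂ (p∈D , _) = gap₁ p∈D

    a∌gap₂ : (2 + r , suc c) ∉ a
    a∌gap₂ p with ∈-move⁻ p
    ... | inj₂ (p∈D , _) = gap₂ p∈D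

    D→a : UnitMove D a
    D→a = unitMove upper∈ upper-rightmost (s≤s z≤n) gap₃

    a→y : UnitMove a y
    a→y = unitMove (∈-move-old middle∈ λ ()) a-row₃ (s≤s z≤n) a∌gap₂

    y→x : KohnertMove y x
    y→x = kohnertMove (∈-move-old ∈-move-new λ ()) rightmost (s≤s z≤n) (s≤s (s≤s (n≤1+n _))) target∉y between
      where
      rightmost : ∀ c' → (3 + r , c') ∈ y → c' ≤ c
      rightmost c' p with ∈-move⁻ p
      ... | inj₂ (p∈a , ≢middle) = a-row₃-left c' p∈a (≢middle ∘ cong (3 + r ,_))
      target∉y : (1 + r , c) ∉ y
      target∉y p with ∈-move⁻ p
      ... | inj₂ (p∈a , _) = a∌gap₁ p∈a
      between : ∀ k → 1 + r < k → k < 3 + r → (k , c) ∈ y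
      between k 1+r<k k<3+r with ≤-antisym (≤-pred k<3+r) 1+r<k
      ... | refl = ∈-move-old (∈-move-old lower∈ λ ()) λ ()

    a→p₁ : UnitMove a p₁
    a→p₁ = unitMove (∈-move-old lower∈ λ ()) rightmost (s≤s z≤n) a∌gap₁
      where
      rightmost : ∀ c' → (2 + r , c') ∈ a → c' ≤ c
      rightmost c' p with ∈-move⁻ p
      ... | inj₂ (p∈D , _) = lower-rightmost c' p∈D

    p₁→p₂ : UnitMove p₁ p₂
    p₁→p₂ = unitMove (∈-move-old (∈-move-old middle∈ λ ()) λ ()) rightmost (s≤s z≤n) target∉p₁
      where
      rightmost : ∀ c' → (3 + r , c') ∈ p₁ → c' ≤ suc c
      rightmost c' p with ∈-move⁻ p
      ... | inj₂ (p∈a , _) = a-row₃ c' p∈a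
      target∉p₁ : (2 + r , suc c) ∉ p₁
      target∉p₁ p with ∈-move⁻ p
      ... | inj₂ (p∈a , _) = a∌gap₂ p∈a

    p₂→x' : UnitMove p₂ x'
    p₂→x' = unitMove (∈-move-old (∈-move-old ∈-move-new λ ()) λ ()) rightmost (s≤s z≤n) target∉p₂
      where
      rightmost : ∀ c' → (3 + r , c') ∈ p₂ → c' ≤ c
      rightmost c' p with ∈-move⁻ p
      ... | inj₂ (p∈p₁ , ≢middle) with ∈-move⁻ p∈p₁
      ...   | inj₁ ()
      ...   | inj₂ (p∈a , _) = a-row₃-left c' p∈a (≢middle ∘ cong (3 + r ,_))
      target∉p₂ : (2 + r , c) ∉ p₂
      target∉p₂ p with ∈-move⁻ p
      ... | inj₂ (p∈p₁ , _) with ∈-move⁻ p∈p₁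
      ...   | inj₁ ()
      ...   | inj₂ (_ , ≢lower) = ≢lower refl

    Endpoint : Cell → Set
    Endpoint z = z ≡ (1 + r , c) ⊎ z ≡ (2 + r , suc c) ⊎ (z ∈ D × z ≢ (4 + r , c) × z ≢ (3 + r , suc c))

    x⇒Endpoint : ∀ {z} → z ∈ x → Endpoint z
    x⇒Endpoint p with ∈-move⁻ p
    ... | inj₁ refl = inj₁ refl
    ... | inj₂ (p∈y , ≢src) with ∈-move⁻ p∈y
    ...   | inj₁ refl = inj₂ (inj₁ refl)
    ...   | inj₂ (p∈a , ≢middle) with ∈-move⁻ p∈a
    ...     | inj₁ refl = ⊥-elim (≢src refl)
    ...     | inj₂ (p∈D , ≢upper) = inj₂ (inj₂ (p∈D , ≢upper , ≢middle))

    Endpoint⇒x : ∀ {z} → Endpoint z → z ∈ x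
    Endpoint⇒x (inj₁ refl) = ∈-move-new
    Endpoint⇒x (inj₂ (inj₁ refl)) = ∈-move-old ∈-move-new λ ()
    Endpoint⇒x (inj₂ (inj₂ (p∈D , ≢upper , ≢middle))) =
      ∈-move-old (∈-move-old (∈-move-old p∈D ≢upper) ≢middle) λ { refl → gap₃ p∈D }

    x'⇒Endpoint : ∀ {z} → z ∈ x' → Endpoint z
    x'⇒Endpoint p with ∈-move⁻ p
    ... | inj₁ refl = inj₂ (inj₂ (lower∈ , (λ ()) , λ ()))
    ... | inj₂ (p∈p₂ , ≢src) with ∈-move⁻ p∈p₂
    ...   | inj₁ refl = inj₂ (inj₁ refl)
    ...   | inj₂ (p∈p₁ , ≢middle) with ∈-move⁻ p∈p₁
    ...     | inj₁ refl = inj₁ refl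
    ...     | inj₂ (p∈a , _) with ∈-move⁻ p∈a
    ...       | inj₁ refl = ⊥-elim (≢src refl)
    ...       | inj₂ (p∈D , ≢upper) = inj₂ (inj₂ (p∈D , ≢upper , ≢middle))

    Endpoint⇒x' : ∀ {z} → Endpoint z → z ∈ x'
    Endpoint⇒x' (inj₁ refl) = ∈-move-old (∈-move-old ∈-move-new λ ()) λ ()
    Endpoint⇒x' (inj₂ (inj₁ refl)) = ∈-move-old ∈-move-new λ ()
    Endpoint⇒x' {z} (inj₂ (inj₂ (p∈D , ≢upper , ≢middle))) with z ≟ᶜ (2 + r , c)
    ... | yes refl = ∈-move-new
    ... | no ≢lower = ∈-move-old (∈-move-old (∈-move-old (∈-move-old p∈D ≢upper) ≢lower) ≢middle) λ { refl → gap₃ p∈D }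

  zigzag⇒¬Ranked : ¬ Ranked D
  zigzag⇒¬Ranked = skip-and-unitMoves⇒¬Ranked box InKD-refl (D→a ◅ a→y ◅ ε) y→x refl ∈-move-new (n<1+n c)
    (D→a ◅ a→p₁ ◅ p₁→p₂ ◅ p₂→x' ◅ ε) λ z → mk⇔ (Endpoint⇒x' ∘ x⇒Endpoint) (Endpoint⇒x ∘ x'⇒Endpoint)

-- Checkered diagrams

Checkered : Parity → ℕ → Cell → Set
Checkered p n (r , c) = (1 ≤ r × r ≤ n) × (1 ≤ c × c ≤ n) × parity (r + c) ≡ p

∈-range1-map : ∀ {y m} (f : ℕ → ℕ) → y ∈ map f (range1 m) → ∃[ i ] ((1 ≤ i × i ≤ m) × y ≡ f i)
∈-range1-map {m = m} f p with ∈-map⁻ f p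
... | i , i∈ , y≡fi with ∈-map⁻ suc i∈
...   | k , k∈ , refl = suc k , (s≤s z≤n , ∈-upTo⁻ k∈) , y≡fi

range1-map-∈ : ∀ {i m} (f : ℕ → ℕ) → 1 ≤ i → i ≤ m → f i ∈ map f (range1 m)
range1-map-∈ {suc k} f _ i≤m = ∈-map⁺ f (∈-map⁺ suc (∈-upTo⁺ i≤m))

∈-grid : ∀ (f g : ℕ → ℕ) a b {r c} →
  (r , c) ∈ concatMap (λ i → map (λ j → (f i , g j)) (range1 b)) (range1 a) ⇔ (r ∈ map f (range1 a) × c ∈ map g (range1 b))
∈-grid f g a b = mk⇔ split join
  where
  split : ∀ {r c} → (r , c) ∈ concatMap (λ i → map (λ j → (f i , g j)) (range1 b)) (range1 a) → _
  split p with find (∈-concatMap⁻ (λ i → map (λ j → (f i , g j)) (range1 b)) {xs = range1 a} p)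
  ... | i , i∈ , q with ∈-map⁻ (λ j → (f i , g j)) q
  ...   | j , j∈ , refl = ∈-map⁺ f i∈ , ∈-map⁺ g j∈
  join : ∀ {r c} → r ∈ map f (range1 a) × c ∈ map g (range1 b) → _
  join (p , q) with ∈-map⁻ f p | ∈-map⁻ g q
  ... | i , i∈ , refl | j , j∈ , refl =
    ∈-concatMap⁺ (λ i → map (λ j → (f i , g j)) (range1 b)) (lose i∈ (∈-map⁺ (λ j → (f i , g j)) j∈))

2*⌊n/2⌋≤n : ∀ n → 2 * ⌊ n /2⌋ ≤ n
2*⌊n/2⌋≤n zero          = z≤n
2*⌊n/2⌋≤n (suc zero)    = z≤n
2*⌊n/2⌋≤n (suc (suc n)) = subst (_≤ 2 + n) (sym (*-suc 2 ⌊ n /2⌋)) (s≤s (s≤s (2*⌊n/2⌋≤n n)))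

parity-even⇒2*⌊n/2⌋≡n : ∀ n → parity n ≡ 0ℙ → 2 * ⌊ n /2⌋ ≡ n
parity-even⇒2*⌊n/2⌋≡n zero          _  = refl
parity-even⇒2*⌊n/2⌋≡n (suc (suc n)) pn = trans (*-suc 2 ⌊ n /2⌋) (cong (2 +_) (parity-even⇒2*⌊n/2⌋≡n n pn))

parity-2* : ∀ i → parity (2 * i) ≡ 0ℙ
parity-2* i = ℙ.*-homo-* 2 i

parity-suc : ∀ n → parity (suc n) ≡ parity n ℙ.⁻¹
parity-suc n = ℙ.+-homo-+ 1 n

∈-evens : ∀ {n r} → r ∈ map (2 *_) (range1 ⌊ n /2⌋) ⇔ ((1 ≤ r × r ≤ n) × parity r ≡ 0ℙ)
∈-evens {n} = mk⇔ to from
  where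
  to : ∀ {r} → r ∈ map (2 *_) (range1 ⌊ n /2⌋) → (1 ≤ r × r ≤ n) × parity r ≡ 0ℙ
  to p with ∈-range1-map (2 *_) p
  ... | suc k , (_ , i≤) , refl = (s≤s z≤n , ≤-trans (*-monoʳ-≤ 2 i≤) (2*⌊n/2⌋≤n n)) , parity-2* (suc k)
  from : ∀ {r} → (1 ≤ r × r ≤ n) × parity r ≡ 0ℙ → r ∈ map (2 *_) (range1 ⌊ n /2⌋)
  from {suc (suc r)} ((_ , r≤n) , pr) =
    subst (_∈ map (2 *_) (range1 ⌊ n /2⌋)) (parity-even⇒2*⌊n/2⌋≡n (2 + r) pr) (range1-map-∈ (2 *_) (s≤s z≤n) (⌊n/2⌋-mono r≤n))

∈-odds : ∀ {n r} → r ∈ map (λ i → 2 * i ∸ 1) (range1 ⌈ n /2⌉) ⇔ ((1 ≤ r × r ≤ n) × parity r ≡ 1ℙ)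
∈-odds {n} = mk⇔ to from
  where
  2*suc∸1 : ∀ k → 2 * suc k ∸ 1 ≡ suc (2 * k)
  2*suc∸1 k = +-suc k (k + 0)
  to : ∀ {r} → r ∈ map (λ i → 2 * i ∸ 1) (range1 ⌈ n /2⌉) → (1 ≤ r × r ≤ n) × parity r ≡ 1ℙ
  to p with ∈-range1-map (λ i → 2 * i ∸ 1) p
  ... | suc k , (_ , i≤) , refl rewrite 2*suc∸1 k =
    (s≤s z≤n , ≤-pred (subst (_≤ suc n) (*-suc 2 k) (≤-trans (*-monoʳ-≤ 2 i≤) (2*⌊n/2⌋≤n (suc n))))) ,
    trans (parity-suc (2 * k)) (cong ℙ._⁻¹ (parity-2* k))
  from : ∀ {r} → (1 ≤ r × r ≤ n) × parity r ≡ 1ℙ → r ∈ map (λ i → 2 * i ∸ 1) (range1 ⌈ n /2⌉)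
  from {suc r} ((_ , r≤n) , pr) =
    subst (_∈ map (λ i → 2 * i ∸ 1) (range1 ⌈ n /2⌉)) (cong (_∸ 1) (parity-even⇒2*⌊n/2⌋≡n (2 + r) (trans (parity-suc (suc r)) (cong ℙ._⁻¹ pr))))
      (range1-map-∈ (λ i → 2 * i ∸ 1) (s≤s z≤n) (⌈n/2⌉-mono r≤n))

parity-+-cancel : ∀ p q → q ≡ (p ℙ.+ q) ℙ.+ p
parity-+-cancel 0ℙ 0ℙ = refl
parity-+-cancel 0ℙ 1ℙ = refl
parity-+-cancel 1ℙ 0ℙ = refl
parity-+-cancel 1ℙ 1ℙ = refl

module _ {n r c : ℕ} where

  private
    Coordinate : ℕ → Parity → Set
    Coordinate k p = (1 ≤ k × k ≤ n) × parity k ≡ p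

  checkered-block : ∀ {p q} → Coordinate r p → Coordinate c q → Checkered (p ℙ.+ q) n (r , c)
  checkered-block (r∈ , pr) (c∈ , pc) = r∈ , c∈ , trans (ℙ.+-homo-+ r c) (cong₂ ℙ._+_ pr pc)

  checkered-column-parity : ∀ {s} → Checkered s n (r , c) → parity c ≡ s ℙ.+ parity r
  checkered-column-parity (_ , _ , prc) =
    trans (parity-+-cancel (parity r) (parity c)) (cong (ℙ._+ parity r) (trans (sym (ℙ.+-homo-+ r c)) prc))

  ∈-Ch1 : (r , c) ∈ Ch1 n ⇔ Checkered 0ℙ n (r , c)
  ∈-Ch1 = mk⇔ to (λ x@(r∈ , c∈ , _) → from (parity r) (r∈ , refl) (c∈ , checkered-column-parity x))
    where
    oddGrid : Diagram
    oddGrid = concatMap (λ i → map (λ j → (2 * i ∸ 1 , 2 * j ∸ 1)) (range1 ⌈ n /2⌉)) (range1 ⌈ n /2⌉)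
    to : (r , c) ∈ Ch1 n → Checkered 0ℙ n (r , c)
    to x∈ with ∈-++⁻ oddGrid x∈
    ... | inj₁ q = let r∈ , c∈ = Equivalence.to (∈-grid _ _ _ _) q in
                   checkered-block (Equivalence.to ∈-odds r∈) (Equivalence.to ∈-odds c∈)
    ... | inj₂ q = let r∈ , c∈ = Equivalence.to (∈-grid _ _ _ _) q in
                   checkered-block (Equivalence.to ∈-evens r∈) (Equivalence.to ∈-evens c∈)
    from : ∀ p → Coordinate r p → Coordinate c p → (r , c) ∈ Ch1 n
    from 1ℙ r∈ c∈ = ∈-++⁺ˡ (Equivalence.from (∈-grid _ _ _ _) (Equivalence.from ∈-odds r∈ , Equivalence.from ∈-odds c∈))
    from 0ℙ r∈ c∈ = ∈-++⁺ʳ oddGrid (Equivalence.from (∈-grid _ _ _ _) (Equivalence.from ∈-evens r∈ , Equivalence.from ∈-evens c∈))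

  ∈-Ch2 : (r , c) ∈ Ch2 n ⇔ Checkered 1ℙ n (r , c)
  ∈-Ch2 = mk⇔ to (λ x@(r∈ , c∈ , _) → from (parity r) (r∈ , refl) (c∈ , checkered-column-parity x))
    where
    oddEvenGrid : Diagram
    oddEvenGrid = concatMap (λ i → map (λ j → (2 * i ∸ 1 , 2 * j)) (range1 ⌊ n /2⌋)) (range1 ⌈ n /2⌉)
    to : (r , c) ∈ Ch2 n → Checkered 1ℙ n (r , c)
    to x∈ with ∈-++⁻ oddEvenGrid x∈
    ... | inj₁ q = let r∈ , c∈ = Equivalence.to (∈-grid _ _ _ _) q in
                   checkered-block (Equivalence.to ∈-odds r∈) (Equivalence.to ∈-evens c∈)
    ... | inj₂ q = let r∈ , c∈ = Equivalence.to (∈-grid _ _ _ _) q in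
                   checkered-block (Equivalence.to ∈-evens r∈) (Equivalence.to ∈-odds c∈)
    from : ∀ p → Coordinate r p → Coordinate c (p ℙ.⁻¹) → (r , c) ∈ Ch2 n
    from 1ℙ r∈ c∈ = ∈-++⁺ˡ (Equivalence.from (∈-grid _ _ _ _) (Equivalence.from ∈-odds r∈ , Equivalence.from ∈-evens c∈))
    from 0ℙ r∈ c∈ = ∈-++⁺ʳ oddEvenGrid (Equivalence.from (∈-grid _ _ _ _) (Equivalence.from ∈-evens r∈ , Equivalence.from ∈-odds c∈))

IsCheckered : Parity → ℕ → Diagram → Set
IsCheckered p n D = ∀ {r c} → (r , c) ∈ D ⇔ Checkered p n (r , c)

module _ {p n D} (checkered : IsCheckered p n D) where

  checkered-box : InBox (suc n) D
  checkered-box x∈ = let (_ , r≤n) , (_ , c≤n) , _ = Equivalence.to checkered x∈ in s≤s r≤n , s≤s c≤n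

  checkered-parity : ∀ {r c} → (r , c) ∈ D → parity (r + c) ≡ p
  checkered-parity x∈ = proj₂ (proj₂ (Equivalence.to checkered x∈))

  checkered-flipped∉ : ∀ {r c} → parity (r + c) ≡ p ℙ.⁻¹ → (r , c) ∉ D
  checkered-flipped∉ prc x∈ = ℙ.p≢p⁻¹ p (trans (sym (checkered-parity x∈)) prc)

  checkered-no-vertical-pair : ∀ {r c} → (suc r , c) ∈ D → (r , c) ∉ D
  checkered-no-vertical-pair {r} {c} above∈ =
    checkered-flipped∉ (trans (sym (ℙ.⁻¹-involutive _)) (cong ℙ._⁻¹ (trans (sym (parity-suc (r + c))) (checkered-parity above∈))))

  checkered-zigzag : ∀ {r c} → 4 + r ≤ n → n ≡ suc c → parity (r + c) ≡ p → Zigzag D r c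
  checkered-zigzag {r} {c} 4+r≤n refl prc = record
    { lower∈           = member (s≤s z≤n) (≤-trans (m≤n+m (2 + r) 2) 4+r≤n) 1≤c (n≤1+n c) prc
    ; middle∈          = member (s≤s z≤n) (≤-trans (m≤n+m (3 + r) 1) 4+r≤n) (s≤s z≤n) ≤-refl (trans (cong (parity ∘ suc) (+-suc r c)) prc)
    ; upper∈           = member (s≤s z≤n) 4+r≤n 1≤c (n≤1+n c) prc
    ; gap₁             = checkered-flipped∉ flipped
    ; gap₂             = checkered-flipped∉ (trans (cong parity (+-suc r c)) flipped)
    ; gap₃             = checkered-flipped∉ flipped
    ; lower-rightmost  = λ c' x∈ → ≤-suc-≢ (column≤ x∈) λ { refl → checkered-flipped∉ (trans (cong parity (+-suc r c)) flipped) x∈ }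
    ; middle-rightmost = λ c' x∈ → column≤ x∈
    ; upper-rightmost  = λ c' x∈ → ≤-suc-≢ (column≤ x∈) λ { refl → checkered-flipped∉ (trans (cong parity (+-suc r c)) flipped) x∈ }
    }
    where
    1≤c : 1 ≤ c
    1≤c = ≤-trans (s≤s z≤n) (≤-pred 4+r≤n)
    member : ∀ {r' c'} → 1 ≤ r' → r' ≤ n → 1 ≤ c' → c' ≤ n → parity (r' + c') ≡ p → (r' , c') ∈ D
    member 1≤r' r'≤n 1≤c' c'≤n pr'c' = Equivalence.from checkered ((1≤r' , r'≤n) , (1≤c' , c'≤n) , pr'c')
    column≤ : ∀ {r' c'} → (r' , c') ∈ D → c' ≤ n
    column≤ x∈ = proj₂ (proj₁ (proj₂ (Equivalence.to checkered x∈)))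
    flipped : parity (suc (r + c)) ≡ p ℙ.⁻¹
    flipped = trans (parity-suc (r + c)) (cong ℙ._⁻¹ prc)

row-of-parity : ∀ p c → ∃[ r ] (r ≤ 1 × parity (r + c) ≡ p)
row-of-parity p c = choose p (parity c) refl
  where
  flipped : ∀ {q} → parity c ≡ q → parity (1 + c) ≡ q ℙ.⁻¹
  flipped pc = trans (parity-suc c) (cong ℙ._⁻¹ pc)
  choose : ∀ p q → parity c ≡ q → ∃[ r ] (r ≤ 1 × parity (r + c) ≡ p)
  choose 0ℙ 0ℙ pc = 0 , z≤n , pc
  choose 1ℙ 1ℙ pc = 0 , z≤n , pc
  choose 0ℙ 1ℙ pc = 1 , s≤s z≤n , flipped pc
  choose 1ℙ 0ℙ pc = 1 , s≤s z≤n , flipped pc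

checkered-¬Ranked : ∀ {p n D} → IsCheckered p n D → 5 ≤ n → ¬ Ranked D
checkered-¬Ranked {p} {suc c} checkered (s≤s 4≤c) with row-of-parity p c
... | r , r≤1 , prc =
  zigzag⇒¬Ranked (checkered-box checkered) (checkered-zigzag checkered (s≤s (≤-trans (+-monoʳ-≤ 3 r≤1) 4≤c)) refl prc)

Ch2-4-¬Ranked : ¬ Ranked (Ch2 4)
Ch2-4-¬Ranked = zigzag⇒¬Ranked (checkered-box (∈-Ch2 {4})) (checkered-zigzag (∈-Ch2 {4}) {0} {3} ≤-refl refl refl)

-- Diagrams with at most three rows

Shallow : Diagram → Set
Shallow D = InBox 4 D × (∀ {c} → (3 , c) ∈ D → (2 , c) ∈ D → (1 , c) ∈ D)

Shallow-resp-≈ : ∀ {D E} → D ≈D E → Shallow E → Shallow D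
Shallow-resp-≈ D≈E (box , closed) =
  InBox-resp-≈ D≈E box , λ p₃ p₂ → Equivalence.from (D≈E _) (closed (Equivalence.to (D≈E _) p₃) (Equivalence.to (D≈E _) p₂))

unit-or-3→1 : ∀ {r r'} → 1 ≤ r' → r' < r → r < 4 → r ≡ suc r' ⊎ (r ≡ 3 × r' ≡ 1)
unit-or-3→1 {2} {1} _ _ _ = inj₁ refl
unit-or-3→1 {3} {2} _ _ _ = inj₁ refl
unit-or-3→1 {3} {1} _ _ _ = inj₂ (refl , refl)
unit-or-3→1 {suc (suc (suc (suc _)))} _ _ (s≤s (s≤s (s≤s (s≤s ()))))
unit-or-3→1 {1} {suc _} _ (s≤s ()) _
unit-or-3→1 {2} {suc (suc _)} _ (s≤s (s≤s ())) _
unit-or-3→1 {3} {suc (suc (suc _))} _ (s≤s (s≤s (s≤s ()))) _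

shallow-unit : ∀ {D D'} → Shallow D → (m : KohnertMove D D') → from-row m ≡ suc (to-row m)
shallow-unit (box , closed) m with unit-or-3→1 (to-row-pos m) (to-row<from-row m) (proj₁ (box (source∈ m)))
... | inj₁ unit = unit
... | inj₂ (r≡3 , r'≡1) = ⊥-elim (target∉ m (subst (λ k → (k , column m) ∈ _) (sym r'≡1)
        (closed (subst (λ k → (k , column m) ∈ _) r≡3 (source∈ m))
                (filled-between m 2 (subst (_< 2) (sym r'≡1) ≤-refl) (subst (2 <_) (sym r≡3) ≤-refl)))))

Shallow-move : ∀ {D D'} → Shallow D → KohnertMove D D' → Shallow D'
Shallow-move {D} {D'} (box , closed) m = InBox-move box m , closed'
  where
  from-row<4 : from-row m < 4
  from-row<4 = proj₁ (box (source∈ m))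
  closed' : ∀ {c} → (3 , c) ∈ D' → (2 , c) ∈ D' → (1 , c) ∈ D'
  closed' p₃ p₂ with after⁻ m p₃ | after⁻ m p₂
  ... | inj₁ refl | _ = ⊥-elim (<-irrefl refl (<-≤-trans (to-row<from-row m) (≤-pred from-row<4)))
  ... | inj₂ (_ , ≢source) | inj₁ refl =
    ⊥-elim (≢source (cong (_, column m) (≤-antisym (to-row<from-row m) (≤-pred from-row<4))))
  ... | inj₂ (p₃∈D , _) | inj₂ (p₂∈D , _) =
    after⁺ m (inj₂ (closed p₃∈D p₂∈D , λ 1≡source → <-irrefl (cong proj₁ 1≡source) (≤-trans (s≤s (to-row-pos m)) (to-row<from-row m))))

Shallow-moves : ∀ {D E} → Shallow D → Star KohnertMove D E → Shallow E
Shallow-moves shallow ε        = shallow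
Shallow-moves shallow (m ◅ ms) = Shallow-moves (Shallow-move shallow m) ms

InKD-shallow : ∀ {D₀ x} → Shallow D₀ → InKD D₀ x → Shallow x
InKD-shallow shallow (E , ms , x≈E) = Shallow-resp-≈ x≈E (Shallow-moves shallow ms)

checkered-shallow : ∀ {p n D} → IsCheckered p n D → n ≤ 3 → Shallow D
checkered-shallow checkered n≤3 =
  (λ x∈ → Product.map (λ r<1+n → ≤-trans r<1+n (s≤s n≤3)) (λ c<1+n → ≤-trans c<1+n (s≤s n≤3)) (checkered-box checkered x∈)) ,
  λ p₃ p₂ → ⊥-elim (checkered-no-vertical-pair checkered p₃ p₂)

shallow⇒Ranked : ∀ {D₀} → Shallow D₀ → Ranked D₀
shallow⇒Ranked {D₀} shallow₀@(box₀ , _) =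
  weight 4 , (λ _ _ _ _ → weight-resp-≈ 4) , (λ _ _ _ y∈ → ≺⇒weight< (InKD-box box₀ y∈)) , covers
  where
  covers : ∀ x y → Covers D₀ y x → weight 4 y ≡ weight 4 x + 1
  covers x y (_ , _ , ((E , ε , x≈E) , x≉y) , _) = ⊥-elim (x≉y x≈E)
  covers x y (_ , y∈ , ((E , _◅_ {j = y₁} m ms , x≈E) , _) , nothing-between)
    with weight-moves (InBox-move (InKD-box box₀ y∈) m) ms
  ... | inj₁ refl = trans (weight-move-by 1 (InKD-box box₀ y∈) m (shallow-unit (InKD-shallow shallow₀ y∈) m))
                          (trans (cong suc (sym (weight-resp-≈ 4 x≈E))) (+-comm 1 _))
  ... | inj₂ lt   = ⊥-elim (nothing-between y₁ (InKD-move y∈ m)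
      ((E , ms , x≈E) , λ x≈y₁ → <-irrefl (trans (sym (weight-resp-≈ 4 x≈E)) (weight-resp-≈ 4 x≈y₁)) lt)
      (move⇒≺ (InKD-box box₀ y∈) m))

-- Extremal elements

unique-maximal : ∀ {N D₀} → InBox N D₀ → Σ[ M ∈ Diagram ] (Maximal D₀ M × ∀ M' → Maximal D₀ M' → M' ≈D M)
unique-maximal {N} {D₀} box₀ =
  D₀ , (InKD-refl , λ z z∈ D₀≺z → <-irrefl refl (<-≤-trans (≺⇒weight< (InKD-box box₀ z∈) D₀≺z) (≼⇒weight≤ box₀ z∈))) , unique
  where
  unique : ∀ M' → Maximal D₀ M' → M' ≈D D₀
  unique M' (M'∈@(E , ms , M'≈E) , maximal) with weight-moves box₀ ms
  ... | inj₁ refl = M'≈E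
  ... | inj₂ lt   = ⊥-elim (maximal D₀ InKD-refl
      (M'∈ , λ M'≈D₀ → <-irrefl (trans (sym (weight-resp-≈ N M'≈E)) (weight-resp-≈ N M'≈D₀)) lt))

Stuck : Diagram → Set
Stuck D = ∀ {D'} → ¬ KohnertMove D D'

Stuck-resp-≈ : ∀ {D E} → D ≈D E → Stuck D → Stuck E
Stuck-resp-≈ D≈E stuck m = stuck (move-resp-≈ (≈D-sym D≈E) m)

stuck⇒Minimal : ∀ {D₀ B} → InKD D₀ B → Stuck B → Minimal D₀ B
stuck⇒Minimal B∈ stuck = B∈ , λ where
  _ _ ((E , ε , z≈E) , z≉B)  → z≉B z≈E
  _ _ ((E , m ◅ _ , _) , _) → stuck m

stuck⇒Bounded : ∀ {N D₀} → InBox N D₀ → Stuck D₀ → Bounded D₀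
stuck⇒Bounded {D₀ = D₀} box₀ stuck = (D₀ , stuck⇒Minimal InKD-refl stuck , unique) , unique-maximal box₀
  where
  unique : ∀ B → Minimal D₀ B → B ≈D D₀
  unique B ((E , ε , B≈E) , _)    = B≈E
  unique B ((E , m ◅ _ , _) , _) = ⊥-elim (stuck m)

sole-move⇒Bounded : ∀ {N D₀ B} → InBox N D₀ → KohnertMove D₀ B → Stuck B →
                    (∀ {D₁} → KohnertMove D₀ D₁ → D₁ ≈D B) → Bounded D₀
sole-move⇒Bounded {N} {D₀} {B} box₀ m₀ stuck sole = (B , stuck⇒Minimal (InKD-move InKD-refl m₀) stuck , unique) , unique-maximal box₀
  where
  unique : ∀ B' → Minimal D₀ B' → B' ≈D B
  unique B' ((E , ε , B'≈D₀) , minimal) =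
    ⊥-elim (minimal B (InKD-move InKD-refl m₀) (move⇒≺ (InBox-resp-≈ B'≈D₀ box₀) (move-resp-≈ (≈D-sym B'≈D₀) m₀)))
  unique B' ((E , m ◅ ε , B'≈E) , _)      = ≈D-trans B'≈E (sole m)
  unique B' ((E , m ◅ m' ◅ _ , _) , _)    = ⊥-elim (Stuck-resp-≈ (≈D-sym (sole m)) stuck m')

two-stuck⇒¬Bounded : ∀ {D₀ B₁ B₂ x} → InKD D₀ B₁ → Stuck B₁ → InKD D₀ B₂ → Stuck B₂ → x ∈ B₁ → x ∉ B₂ → ¬ Bounded D₀
two-stuck⇒¬Bounded {x = x} B₁∈ stuck₁ B₂∈ stuck₂ x∈B₁ x∉B₂ ((B , _ , unique) , _) =
  x∉B₂ (Equivalence.from (unique _ (stuck⇒Minimal B₂∈ stuck₂) x) (Equivalence.to (unique _ (stuck⇒Minimal B₁∈ stuck₁) x) x∈B₁))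

-- Checkered diagrams with n ≤ 4

Movable : Diagram → ℕ → ℕ → ℕ → Set
Movable D r c r' = (r , c) ∈ D × All (λ x → proj₁ x ≡ r → proj₂ x ≤ c) D × 1 ≤ r' × r' < r × (r' , c) ∉ D
                   × All (λ k → r' < k → (k , c) ∈ D) (upTo r)

movable? : ∀ D r c r' → Dec (Movable D r c r')
movable? D r c r' = ((r , c) ∈? D) ×-dec all? (λ x → (proj₁ x ≟ r) →-dec (proj₂ x ≤? c)) D ×-dec (1 ≤? r') ×-dec (r' <? r)
                    ×-dec ¬? ((r' , c) ∈? D) ×-dec all? (λ k → (r' <? k) →-dec ((k , c) ∈? D)) (upTo r)

kohnertMove# : ∀ D r c r' → {True (movable? D r c r')} → KohnertMove D (move (r , c) r' D)
kohnertMove# D r c r' {t} with toWitness t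
... | src , rightmost , pos , r'<r , tgt , between =
  kohnertMove src (λ c' p → All-lookup rightmost p refl) pos r'<r tgt (λ k p q → All-lookup between (∈-upTo⁺ q) p)

unitMove# : ∀ D c r → {True (movable? D (suc r) c r)} → UnitMove D (move (suc r , c) r D)
unitMove# D c r {t} = kohnertMove# D (suc r) c r {t} , refl

∈# : ∀ x D → {True (x ∈? D)} → x ∈ D
∈# x D {t} = toWitness t

∉# : ∀ x D → {True (¬? (x ∈? D))} → x ∉ D
∉# x D {t} = toWitness t

≈D# : ∀ D E → {True (all? (_∈? E) D ×-dec all? (_∈? D) E)} → D ≈D E
≈D# D E {t} = let D⊆E , E⊆D = toWitness t in λ x → mk⇔ (All-lookup D⊆E) (All-lookup E⊆D)

Immovable : Diagram → Cell → Set
Immovable D (r , c) = Any (λ (r' , c') → r' ≡ r × c < c') D ⊎ All (λ k → 1 ≤ k → (k , c) ∈ D) (upTo r)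

immovable? : ∀ D x → Dec (Immovable D x)
immovable? D (r , c) = any? (λ (r' , c') → (r' ≟ r) ×-dec (c <? c')) D ⊎-dec all? (λ k → (1 ≤? k) →-dec ((k , c) ∈? D)) (upTo r)

stuck# : ∀ D → {True (all? (immovable? D) D)} → Stuck D
stuck# D {t} m with All-lookup (toWitness t) (source∈ m)
... | inj₁ right with find right
...   | _ , right∈ , refl , c<c' = <-irrefl refl (<-≤-trans c<c' (source-rightmost m _ right∈))
stuck# D {t} m | inj₂ filled = target∉ m (All-lookup filled (∈-upTo⁺ (to-row<from-row m)) (to-row-pos m))

opaque
  unfolding move

  Ch1-2-Bounded : Bounded (Ch1 2)
  Ch1-2-Bounded = sole-move⇒Bounded (checkered-box (∈-Ch1 {2})) (kohnertMove# (Ch1 2) 2 2 1) (stuck# _) sole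
    where
    sole : ∀ {D₁} → KohnertMove (Ch1 2) D₁ → D₁ ≈D move (2 , 2) 1 (Ch1 2)
    sole (_ , _ , _ , here refl , _ , s≤s z≤n , s≤s () , _)
    sole m@(_ , _ , _ , there (here refl) , _ , s≤s z≤n , s≤s (s≤s z≤n) , _) = ≈move m

  Ch2-2-Bounded : Bounded (Ch2 2)
  Ch2-2-Bounded = sole-move⇒Bounded (checkered-box (∈-Ch2 {2})) (kohnertMove# (Ch2 2) 2 1 1) (stuck# _) sole
    where
    sole : ∀ {D₁} → KohnertMove (Ch2 2) D₁ → D₁ ≈D move (2 , 1) 1 (Ch2 2)
    sole (_ , _ , _ , here refl , _ , s≤s z≤n , s≤s () , _)
    sole m@(_ , _ , _ , there (here refl) , _ , s≤s z≤n , s≤s (s≤s z≤n) , _) = ≈move m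

  Ch1-3-¬Bounded : ¬ Bounded (Ch1 3)
  Ch1-3-¬Bounded = two-stuck⇒¬Bounded
    (_ , kohnertMove# D₀ 3 3 2 ◅ kohnertMove# b 3 1 2 ◅ ε , ≈D-refl) (stuck# B₁)
    (_ , kohnertMove# D₀ 2 2 1 ◅ kohnertMove# b' 3 3 2 ◅ kohnertMove# b'' 3 1 2 ◅ ε , ≈D-refl) (stuck# B₂)
    (∈# (2 , 2) B₁) (∉# (2 , 2) B₂)
    where
    D₀ b B₁ b' b'' B₂ : Diagram
    D₀ = Ch1 3
    b  = move (3 , 3) 2 D₀
    B₁ = move (3 , 1) 2 b
    b' = move (2 , 2) 1 D₀
    b'' = move (3 , 3) 2 b'
    B₂ = move (3 , 1) 2 b''

  Ch2-3-¬Bounded : ¬ Bounded (Ch2 3)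
  Ch2-3-¬Bounded = two-stuck⇒¬Bounded
    (_ , kohnertMove# D₀ 2 3 1 ◅ kohnertMove# b 3 2 2 ◅ ε , ≈D-refl) (stuck# B₁)
    (_ , kohnertMove# D₀ 2 3 1 ◅ kohnertMove# b 2 1 1 ◅ kohnertMove# b' 3 2 2 ◅ ε , ≈D-refl) (stuck# B₂)
    (∈# (2 , 1) B₁) (∉# (2 , 1) B₂)
    where
    D₀ b B₁ b' B₂ : Diagram
    D₀ = Ch2 3
    b  = move (2 , 3) 1 D₀
    B₁ = move (3 , 2) 2 b
    b' = move (2 , 1) 1 b
    B₂ = move (3 , 2) 2 b'

  -- Ch1 4 contains no zigzag, but three unit moves lead to a diagram with the same two competing routes.
  Ch1-4-¬Ranked : ¬ Ranked (Ch1 4)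
  Ch1-4-¬Ranked = skip-and-unitMoves⇒¬Ranked (checkered-box (∈-Ch1 {4}))
    (InKD-unitMoves InKD-refl (unitMove# D₀ 4 1 ◅ unitMove# a₁ 4 3 ◅ unitMove# a₂ 2 3 ◅ ε))
    (unitMove# a 4 2 ◅ unitMove# y₁ 3 2 ◅ ε) (kohnertMove# y 3 2 1) refl (∈# (2 , 4) y) (s≤s (s≤s (s≤s z≤n)))
    (unitMove# a 2 1 ◅ unitMove# p₁ 4 2 ◅ unitMove# p₂ 3 2 ◅ unitMove# p₃ 2 2 ◅ ε)
    (≈D# (move (3 , 2) 1 y) (move (3 , 2) 2 p₃))
    where
    D₀ a₁ a₂ a y₁ y p₁ p₂ p₃ : Diagram
    D₀ = Ch1 4
    a₁ = move (2 , 4) 1 D₀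
    a₂ = move (4 , 4) 3 a₁
    a  = move (4 , 2) 3 a₂
    y₁ = move (3 , 4) 2 a
    y  = move (3 , 3) 2 y₁
    p₁ = move (2 , 2) 1 a
    p₂ = move (3 , 4) 2 p₁
    p₃ = move (3 , 3) 2 p₂

Ch-checkered : ∀ {n D₀} → D₀ ≡ Ch1 n ⊎ D₀ ≡ Ch2 n → ∃[ p ] IsCheckered p n D₀
Ch-checkered (inj₁ refl) = 0ℙ , ∈-Ch1
Ch-checkered (inj₂ refl) = 1ℙ , ∈-Ch2

Ch-¬Ranked : ∀ {n D₀} → 4 ≤ n → D₀ ≡ Ch1 n ⊎ D₀ ≡ Ch2 n → ¬ Ranked D₀
Ch-¬Ranked {0} ()
Ch-¬Ranked {1} (s≤s ())
Ch-¬Ranked {2} (s≤s (s≤s ()))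
Ch-¬Ranked {3} (s≤s (s≤s (s≤s ())))
Ch-¬Ranked {4} _ (inj₁ refl) = Ch1-4-¬Ranked
Ch-¬Ranked {4} _ (inj₂ refl) = Ch2-4-¬Ranked
Ch-¬Ranked {suc (suc (suc (suc (suc _))))} _ D₀≡ =
  checkered-¬Ranked (proj₂ (Ch-checkered D₀≡)) (s≤s (s≤s (s≤s (s≤s (s≤s z≤n)))))

Ch-Bounded : ∀ {n D₀} → 1 ≤ n → n ≤ 2 → D₀ ≡ Ch1 n ⊎ D₀ ≡ Ch2 n → Bounded D₀
Ch-Bounded {0} ()
Ch-Bounded {suc (suc (suc _))} _ (s≤s (s≤s ()))
Ch-Bounded {1} _ _ (inj₁ refl) = stuck⇒Bounded (checkered-box (∈-Ch1 {1})) (stuck# (Ch1 1))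
Ch-Bounded {1} _ _ (inj₂ refl) = stuck⇒Bounded (checkered-box (∈-Ch2 {1})) (stuck# (Ch2 1))
Ch-Bounded {2} _ _ (inj₁ refl) = Ch1-2-Bounded
Ch-Bounded {2} _ _ (inj₂ refl) = Ch2-2-Bounded

Ch-3-¬Bounded : ∀ {D₀} → D₀ ≡ Ch1 3 ⊎ D₀ ≡ Ch2 3 → ¬ Bounded D₀
Ch-3-¬Bounded (inj₁ refl) = Ch1-3-¬Bounded
Ch-3-¬Bounded (inj₂ refl) = Ch2-3-¬Bounded

theorem7p1 : ∀ (n : ℕ) → 1 ≤ n → ∀ (D₀ : Diagram) → (D₀ ≡ Ch1 n ⊎ D₀ ≡ Ch2 n)
    → (Ranked D₀ ⇔ n ≤ 3) × ((Ranked D₀ × Bounded D₀) ⇔ n ≤ 2)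
theorem7p1 n 1≤n D₀ D₀≡ = mk⇔ ranked⇒≤3 ≤3⇒ranked , mk⇔ ranked∧bounded⇒≤2 ≤2⇒ranked∧bounded
  where
  ≤3⇒ranked : n ≤ 3 → Ranked D₀
  ≤3⇒ranked n≤3 = shallow⇒Ranked (checkered-shallow (proj₂ (Ch-checkered D₀≡)) n≤3)

  ranked⇒≤3 : Ranked D₀ → n ≤ 3
  ranked⇒≤3 ranked with n ≤? 3
  ... | yes n≤3 = n≤3
  ... | no  n≰3 = ⊥-elim (Ch-¬Ranked (≰⇒> n≰3) D₀≡ ranked)

  ranked∧bounded⇒≤2 : Ranked D₀ × Bounded D₀ → n ≤ 2
  ranked∧bounded⇒≤2 (ranked , bounded) with n ≤? 2
  ... | yes n≤2 = n≤2
  ... | no  n≰2 = ⊥-elim (Ch-3-¬Bounded (subst (λ k → D₀ ≡ Ch1 k ⊎ D₀ ≡ Ch2 k) n≡3 D₀≡) bounded)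
    where
    n≡3 : n ≡ 3
    n≡3 = ≤-antisym (ranked⇒≤3 ranked) (≰⇒> n≰2)

  ≤2⇒ranked∧bounded : n ≤ 2 → Ranked D₀ × Bounded D₀
  ≤2⇒ranked∧bounded n≤2 = ≤3⇒ranked (m≤n⇒m≤1+n n≤2) , Ch-Bounded 1≤n n≤2 D₀≡
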